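{- For all $w\in F_2$, $\omega(\mathrm{Pal}(w))=\mathrm{Pal}(w)$, i.e. $\mathrm{Pal}(w)$ is a palindrome.
   Context: $F_2$ is the free group on $a,b$. $w\mapsto R_w$ is the group homomorphism $F_2\to\mathrm{Aut}(F_2)$ with $R_a(a)=a$, $R_a(b)=ba$, $R_b(a)=ab$, $R_b(b)=b$. The palindromization map $\mathrm{Pal}:F_2\to F_2$ is defined by $\mathrm{Pal}(w)=b^{ -1}a^{ -1}R_w(ab)$. $\omega$ is the unique anti-automorphism of $F_2$ with $\omega(a)=a$, $\omega(b)=b$ (mirror image); a palindrome is an element fixed by $\omega$. -}

module Defs where

open import Data.Bool using (Bool; true; false; not; _∧_)
open import Data.List using (List; []; _∷_; _++_; reverse; map; concatMap; foldr)
open import Relation.Binary.PropositionalEquality using (_≡_)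

data Gen : Set where
  a b : Gen

-- A letter: a generator with a sign (true = positive, false = inverse)
record Letter : Set where
  constructor _^_
  field
    gen : Gen
    pos : Bool

Word : Set
Word = List Letter

invL : Letter → Letter
invL (g ^ s) = g ^ not s

eqGen : Gen → Gen → Bool
eqGen a a = true
eqGen b b = true
eqGen _ _ = false

cancels : Letter → Letter → Bool
cancels (g ^ true)  (h ^ false) = eqGen g h
cancels (g ^ false) (h ^ true)  = eqGen g h
cancels _ _ = false

push : Letter → Word → Word
push x [] = x ∷ []
push x (y ∷ ys) with cancels x y
... | true  = ys
... | false = x ∷ y ∷ ys

reduce : Word → Word
reduce = foldr push []

-- F₂ is presented as words modulo free reduction:
-- two words represent the same element iff they have the same reduced form.
_≈_ : Word → Word → Set
u ≈ v = reduce u ≡ reduce v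

ε : Word
ε = []

_·_ : Word → Word → Word
u · v = u ++ v

inv : Word → Word
inv u = reverse (map invL u)

gen : Gen → Word
gen g = (g ^ true) ∷ []

ga gb : Word
ga = gen a
gb = gen b

subst : (Gen → Word) → Word → Word
subst f = concatMap λ { (g ^ true) → f g ; (g ^ false) → inv (f g) }

imgR : Letter → Gen → Word
imgR (a ^ true)  a = ga
imgR (a ^ true)  b = gb · ga
imgR (b ^ true)  a = ga · gb
imgR (b ^ true)  b = gb
imgR (a ^ false) a = ga
imgR (a ^ false) b = gb · inv ga
imgR (b ^ false) a = ga · inv gb
imgR (b ^ false) b = gb

R : Word → Word → Word
R [] v = v
R (x ∷ w) v = subst (imgR x) (R w v)

Pal : Word → Word
Pal w = inv gb · (inv ga · R w (ga · gb))

-- ω: the anti-automorphism fixing a and b (mirror image)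
ω : Word → Word
ω = reverse

module Submission where

-- Writing R_x for the elementary automorphism of a letter x, the proof rests
-- on two facts about F₂:
--   (1) Pal(xw) = x · R_x(Pal w), since R_w(ab) = ab · Pal(w) and
--       b⁻¹a⁻¹R_x(ab) = x for each of the four letters x;
--   (2) the mirror image twists R_x by an inner automorphism:
--       ω(R_x(u)) = x · R_x(ω u) · x⁻¹, which is checked on letters and then
--       propagated to all words because ω and R_x are (anti-)homomorphisms.
-- Then ω(Pal(xw)) = ω(R_x(Pal w)) · x = x · R_x(ω(Pal w)) = x · R_x(Pal w)
-- = Pal(xw), using the induction hypothesis ω(Pal w) = Pal w.

open import Defs
open import Data.Bool using (true; false)
open import Data.List using ([]; _∷_; _++_; reverse; map; foldr)
open import Data.List.Properties
  using (foldr-++; concatMap-++; ++-assoc; ++-identityʳ; reverse-++; unfold-reverse)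
open import Data.Product using (_×_; _,_)
open import Data.Unit using (⊤; tt)
open import Relation.Binary.Bundles using (Setoid)
open import Relation.Binary.PropositionalEquality
  using (_≡_; refl; sym; trans; cong)
import Relation.Binary.Reasoning.Setoid as SetoidReasoning

eqGen-sound : ∀ g h → eqGen g h ≡ true → g ≡ h
eqGen-sound a a _ = refl
eqGen-sound b b _ = refl
eqGen-sound a b ()
eqGen-sound b a ()

invL-involutive : ∀ x → invL (invL x) ≡ x
invL-involutive (g ^ true)  = refl
invL-involutive (g ^ false) = refl

cancels-invL : ∀ x → cancels x (invL x) ≡ true
cancels-invL (a ^ true)  = refl
cancels-invL (b ^ true)  = refl
cancels-invL (a ^ false) = refl
cancels-invL (b ^ false) = refl

cancels-sound : ∀ x y → cancels x y ≡ true → y ≡ invL x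
cancels-sound (g ^ true)  (h ^ false) e rewrite eqGen-sound g h e = refl
cancels-sound (g ^ false) (h ^ true)  e rewrite eqGen-sound g h e = refl
cancels-sound (g ^ true)  (h ^ true)  ()
cancels-sound (g ^ false) (h ^ false) ()

Reduced : Word → Set
Reduced []           = ⊤
Reduced (x ∷ [])     = ⊤
Reduced (x ∷ y ∷ ys) = (cancels x y ≡ false) × Reduced (y ∷ ys)

reduced-tail : ∀ {y} ys → Reduced (y ∷ ys) → Reduced ys
reduced-tail []       _       = tt
reduced-tail (_ ∷ _) (_ , r) = r

push-reduced : ∀ x r → Reduced r → Reduced (push x r)
push-reduced x []       _ = tt
push-reduced x (y ∷ ys) r with cancels x y in e
... | true  = reduced-tail ys r
... | false = e , r

reduce-reduced : ∀ u → Reduced (reduce u)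
reduce-reduced []      = tt
reduce-reduced (x ∷ u) = push-reduced x (reduce u) (reduce-reduced u)

push-head : ∀ x ys → Reduced (x ∷ ys) → push x ys ≡ x ∷ ys
push-head x []       _       = refl
push-head x (z ∷ zs) (e , _) rewrite e = refl

push-invL : ∀ x r → Reduced r → push x (push (invL x) r) ≡ r
push-invL x []       _ rewrite cancels-invL x = refl
push-invL x (y ∷ ys) r with cancels (invL x) y in e
... | false rewrite cancels-invL x = refl
... | true with cancels-sound (invL x) y e
...   | refl rewrite invL-involutive x = push-head x ys r

reduce-push-++ : ∀ x r v → Reduced r →
                 reduce (push x r ++ v) ≡ push x (reduce (r ++ v))
reduce-push-++ x []       v _ = refl
reduce-push-++ x (y ∷ ys) v _ with cancels x y in e
... | false = refl
... | true with cancels-sound x y e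
...   | refl = sym (push-invL x (reduce (ys ++ v)) (reduce-reduced (ys ++ v)))

reduce-prefix : ∀ u v → reduce (u ++ v) ≡ reduce (reduce u ++ v)
reduce-prefix []      v = refl
reduce-prefix (x ∷ u) v = trans (cong (push x) (reduce-prefix u v))
                                (sym (reduce-push-++ x (reduce u) v (reduce-reduced u)))

-- It is Defs' relation _≈_ wrapped in a record, so that both
-- words remain visible to unification (u ≈ v unfolds to an equation between
-- reduced forms, from which u and v cannot be inferred).
record _≃_ (u v : Word) : Set where
  constructor reduces-to-same
  field ≃⇒≈ : u ≈ v
open _≃_ public

infix 4 _≃_

≃-refl : ∀ {u} → u ≃ u
≃-refl = reduces-to-same refl

≃-sym : ∀ {u v} → u ≃ v → v ≃ u
≃-sym (reduces-to-same e) = reduces-to-same (sym e)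

≃-trans : ∀ {u v w} → u ≃ v → v ≃ w → u ≃ w
≃-trans (reduces-to-same e) (reduces-to-same f) = reduces-to-same (trans e f)

≡⇒≃ : ∀ {u v} → u ≡ v → u ≃ v
≡⇒≃ refl = ≃-refl

≃-setoid : Setoid _ _
≃-setoid = record
  { Carrier       = Word
  ; _≈_           = _≃_
  ; isEquivalence = record { refl = ≃-refl ; sym = ≃-sym ; trans = ≃-trans }
  }

module ≃-Reasoning = SetoidReasoning ≃-setoid

-- Multiplication is well defined on F₂: left factors act on reduced forms,
-- and right factors may be reduced first.
·-congʳ : ∀ u {v v'} → v ≃ v' → u · v ≃ u · v'
·-congʳ u {v} {v'} (reduces-to-same e) = reduces-to-same
  (trans (foldr-++ push [] u v)
         (trans (cong (λ t → foldr push t u) e) (sym (foldr-++ push [] u v'))))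

·-congˡ : ∀ {u u'} v → u ≃ u' → u · v ≃ u' · v
·-congˡ {u} {u'} v (reduces-to-same e) = reduces-to-same
  (trans (reduce-prefix u v)
         (trans (cong (λ t → reduce (t ++ v)) e) (sym (reduce-prefix u' v))))

·-cong : ∀ {u u' v v'} → u ≃ u' → v ≃ v' → u · v ≃ u' · v'
·-cong {u' = u'} {v = v} e f = ≃-trans (·-congˡ v e) (·-congʳ u' f)

cancel-letter : ∀ x v → x ∷ invL x ∷ v ≃ v
cancel-letter x v = reduces-to-same (push-invL x (reduce v) (reduce-reduced v))

cancel-letter⁻¹ : ∀ x v → invL x ∷ x ∷ v ≃ v
cancel-letter⁻¹ x v with cancel-letter (invL x) v
... | e rewrite invL-involutive x = e

inv-cons : ∀ x u → inv (x ∷ u) ≡ inv u ++ invL x ∷ []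
inv-cons x u = unfold-reverse (invL x) (map invL u)

cancel-inv : ∀ u v → u · (inv u · v) ≃ v
cancel-inv []      v = ≃-refl
cancel-inv (x ∷ u) v = begin
  x ∷ u ++ inv (x ∷ u) ++ v              ≡⟨ cong (λ t → x ∷ u ++ t ++ v) (inv-cons x u) ⟩
  x ∷ u ++ (inv u ++ invL x ∷ []) ++ v   ≡⟨ cong (λ t → x ∷ u ++ t) (++-assoc (inv u) _ v) ⟩
  x ∷ u ++ inv u ++ invL x ∷ v           ≈⟨ ·-congʳ (x ∷ []) (cancel-inv u (invL x ∷ v)) ⟩
  x ∷ invL x ∷ v                         ≈⟨ cancel-letter x v ⟩
  v                                      ∎
  where open ≃-Reasoning

inv-cancel : ∀ u v → inv u · (u · v) ≃ v
inv-cancel []      v = ≃-refl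
inv-cancel (x ∷ u) v = begin
  inv (x ∷ u) ++ x ∷ u ++ v              ≡⟨ cong (_++ x ∷ u ++ v) (inv-cons x u) ⟩
  (inv u ++ invL x ∷ []) ++ x ∷ u ++ v   ≡⟨ ++-assoc (inv u) _ (x ∷ u ++ v) ⟩
  inv u ++ invL x ∷ x ∷ u ++ v           ≈⟨ ·-congʳ (inv u) (cancel-letter⁻¹ x (u ++ v)) ⟩
  inv u ++ u ++ v                        ≈⟨ inv-cancel u v ⟩
  v                                      ∎
  where open ≃-Reasoning

-- A map on words is well defined on F₂ as soon as it is compatible with
-- prefixing a letter and deletes adjacent inverse pairs: then it cannot see
-- the difference between a word and its free reduction.
descends : (φ : Word → Word)
         → (∀ x {u u'} → φ u ≃ φ u' → φ (x ∷ u) ≃ φ (x ∷ u'))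
         → (∀ x u → φ (x ∷ invL x ∷ u) ≃ φ u)
         → ∀ {u v} → u ≃ v → φ u ≃ φ v
descends φ prefix deletes {u} {v} (reduces-to-same e) =
  ≃-trans (φ-reduce u) (≃-trans (≡⇒≃ (cong φ e)) (≃-sym (φ-reduce v)))
  where
    φ-push : ∀ x r → φ (x ∷ r) ≃ φ (push x r)
    φ-push x []       = ≃-refl
    φ-push x (y ∷ ys) with cancels x y in c
    ... | false = ≃-refl
    ... | true with cancels-sound x y c
    ...   | refl = deletes x ys

    φ-reduce : ∀ u → φ u ≃ φ (reduce u)
    φ-reduce []      = ≃-refl
    φ-reduce (x ∷ u) = ≃-trans (prefix x (φ-reduce u)) (φ-push x (reduce u))

ω-cong : ∀ {u v} → u ≃ v → ω u ≃ ω v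
ω-cong = descends reverse prefix deletes
  where
    open ≃-Reasoning

    prefix : ∀ x {u u'} → reverse u ≃ reverse u' → reverse (x ∷ u) ≃ reverse (x ∷ u')
    prefix x {u} {u'} e = begin
      reverse (x ∷ u)    ≡⟨ unfold-reverse x u ⟩
      reverse u ++ x ∷ []  ≈⟨ ·-congˡ (x ∷ []) e ⟩
      reverse u' ++ x ∷ [] ≡⟨ unfold-reverse x u' ⟨
      reverse (x ∷ u')   ∎

    deletes : ∀ x u → reverse (x ∷ invL x ∷ u) ≃ reverse u
    deletes x u = begin
      reverse (x ∷ invL x ∷ u)        ≡⟨ reverse-++ (x ∷ invL x ∷ []) u ⟩
      reverse u ++ invL x ∷ x ∷ []    ≈⟨ ·-congʳ (reverse u) (cancel-letter⁻¹ x []) ⟩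
      reverse u ++ []                 ≡⟨ ++-identityʳ (reverse u) ⟩
      reverse u                       ∎

img : (Gen → Word) → Letter → Word
img f (g ^ true)  = f g
img f (g ^ false) = inv (f g)

subst-cons : ∀ f x u → subst f (x ∷ u) ≡ img f x ++ subst f u
subst-cons f (g ^ true)  u = refl
subst-cons f (g ^ false) u = refl

subst-++ : ∀ f u v → subst f (u ++ v) ≡ subst f u ++ subst f v
subst-++ f = concatMap-++ _

subst-cong : ∀ f {u v} → u ≃ v → subst f u ≃ subst f v
subst-cong f = descends (subst f) prefix deletes
  where
    open ≃-Reasoning

    prefix : ∀ x {u u'} → subst f u ≃ subst f u' → subst f (x ∷ u) ≃ subst f (x ∷ u')
    prefix x {u} {u'} e = begin
      subst f (x ∷ u)      ≡⟨ subst-cons f x u ⟩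
      img f x ++ subst f u  ≈⟨ ·-congʳ (img f x) e ⟩
      img f x ++ subst f u' ≡⟨ subst-cons f x u' ⟨
      subst f (x ∷ u')     ∎

    deletes : ∀ x u → subst f (x ∷ invL x ∷ u) ≃ subst f u
    deletes (g ^ true)  u = cancel-inv (f g) (subst f u)
    deletes (g ^ false) u = inv-cancel (f g) (subst f u)

subst-snoc : ∀ f u y → subst f (u ++ y ∷ []) ≡ subst f u ++ img f y
subst-snoc f u y = trans (subst-++ f u (y ∷ []))
  (cong (subst f u ++_) (trans (subst-cons f y []) (++-identityʳ (img f y))))

·-inverseʳ : ∀ u → u · inv u ≃ ε
·-inverseʳ u = ≃-trans (≡⇒≃ (cong (u ++_) (sym (++-identityʳ (inv u))))) (cancel-inv u ε)

cancel-inv-right : ∀ u c → (u · inv c) · c ≃ u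
cancel-inv-right u c = begin
  (u ++ inv c) ++ c     ≡⟨ ++-assoc u (inv c) c ⟩
  u ++ inv c ++ c       ≡⟨ cong (λ t → u ++ inv c ++ t) (++-identityʳ c) ⟨
  u ++ inv c ++ c ++ [] ≈⟨ ·-congʳ u (inv-cancel c []) ⟩
  u ++ []               ≡⟨ ++-identityʳ u ⟩
  u                     ∎
  where open ≃-Reasoning

-- If the substitution f turns the mirror image of each letter image into its
-- conjugate by c, then ω ∘ f = (conjugation by c) ∘ f ∘ ω on all of F₂,
-- because both sides are anti-homomorphisms agreeing on letters.
mirror-subst : ∀ f c → (∀ y → ω (img f y) ≃ c · (img f y · inv c))
             → ∀ u → ω (subst f u) ≃ c · (subst f (ω u) · inv c)
mirror-subst f c mirror-img []      = ≃-sym (·-inverseʳ c)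
mirror-subst f c mirror-img (y ∷ u) = begin
  ω (subst f (y ∷ u))                    ≡⟨ cong reverse (subst-cons f y u) ⟩
  reverse (I ++ S)                       ≡⟨ reverse-++ I S ⟩
  ω S ++ ω I                             ≈⟨ ·-cong (mirror-subst f c mirror-img u) (mirror-img y) ⟩
  (c ++ S' ++ inv c) ++ c ++ I ++ inv c  ≡⟨ ++-assoc c (S' ++ inv c) _ ⟩
  c ++ (S' ++ inv c) ++ c ++ I ++ inv c  ≡⟨ cong (c ++_) (++-assoc S' (inv c) _) ⟩
  c ++ S' ++ inv c ++ c ++ I ++ inv c    ≈⟨ ·-congʳ c (·-congʳ S' (inv-cancel c (I ++ inv c))) ⟩
  c ++ S' ++ I ++ inv c                  ≡⟨ cong (c ++_) (++-assoc S' I (inv c)) ⟨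
  c ++ (S' ++ I) ++ inv c                ≡⟨ cong (λ t → c ++ t ++ inv c) mirror-cons ⟨
  c ++ subst f (ω (y ∷ u)) ++ inv c      ∎
  where
    open ≃-Reasoning
    I  = img f y
    S  = subst f u
    S' = subst f (ω u)

    mirror-cons : subst f (ω (y ∷ u)) ≡ S' ++ I
    mirror-cons = trans (cong (subst f) (unfold-reverse y u)) (subst-snoc f (ω u) y)

Rₓ : Letter → Word → Word
Rₓ x = subst (imgR x)

mirror-imgR : ∀ x y → ω (img (imgR x) y) ≃ (x ∷ []) · (img (imgR x) y · inv (x ∷ []))
mirror-imgR (a ^ true)  (a ^ true)  = reduces-to-same refl
mirror-imgR (a ^ true)  (b ^ true)  = reduces-to-same refl
mirror-imgR (a ^ true)  (a ^ false) = reduces-to-same refl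
mirror-imgR (a ^ true)  (b ^ false) = reduces-to-same refl
mirror-imgR (b ^ true)  (a ^ true)  = reduces-to-same refl
mirror-imgR (b ^ true)  (b ^ true)  = reduces-to-same refl
mirror-imgR (b ^ true)  (a ^ false) = reduces-to-same refl
mirror-imgR (b ^ true)  (b ^ false) = reduces-to-same refl
mirror-imgR (a ^ false) (a ^ true)  = reduces-to-same refl
mirror-imgR (a ^ false) (b ^ true)  = reduces-to-same refl
mirror-imgR (a ^ false) (a ^ false) = reduces-to-same refl
mirror-imgR (a ^ false) (b ^ false) = reduces-to-same refl
mirror-imgR (b ^ false) (a ^ true)  = reduces-to-same refl
mirror-imgR (b ^ false) (b ^ true)  = reduces-to-same refl
mirror-imgR (b ^ false) (a ^ false) = reduces-to-same refl
mirror-imgR (b ^ false) (b ^ false) = reduces-to-same refl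

mirror-Rₓ : ∀ x u → ω (Rₓ x u) ≃ (x ∷ Rₓ x (ω u)) · inv (x ∷ [])
mirror-Rₓ x = mirror-subst (imgR x) (x ∷ []) (mirror-imgR x)

ab : Word
ab = ga · gb

R-ab : ∀ w → R w ab ≃ ab · Pal w
R-ab w = ≃-sym (cancel-inv ab (R w ab))

Pal-letter : ∀ x → inv ab · Rₓ x ab ≃ x ∷ []
Pal-letter (a ^ true)  = reduces-to-same refl
Pal-letter (b ^ true)  = reduces-to-same refl
Pal-letter (a ^ false) = reduces-to-same refl
Pal-letter (b ^ false) = reduces-to-same refl

Pal-cons : ∀ x w → Pal (x ∷ w) ≃ x ∷ Rₓ x (Pal w)
Pal-cons x w = begin
  inv ab · Rₓ x (R w ab)                 ≈⟨ ·-congʳ (inv ab) (subst-cong (imgR x) (R-ab w)) ⟩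
  inv ab · Rₓ x (ab · Pal w)             ≡⟨ cong (inv ab ++_) (subst-++ (imgR x) ab (Pal w)) ⟩
  inv ab · (Rₓ x ab · Rₓ x (Pal w))      ≡⟨ ++-assoc (inv ab) (Rₓ x ab) (Rₓ x (Pal w)) ⟨
  (inv ab · Rₓ x ab) · Rₓ x (Pal w)      ≈⟨ ·-congˡ (Rₓ x (Pal w)) (Pal-letter x) ⟩
  x ∷ Rₓ x (Pal w)                       ∎
  where open ≃-Reasoning

palindrome : ∀ w → ω (Pal w) ≃ Pal w
palindrome []      = reduces-to-same refl
palindrome (x ∷ w) = begin
  ω (Pal (x ∷ w))                        ≈⟨ ω-cong (Pal-cons x w) ⟩
  ω (x ∷ Rₓ x P)                         ≡⟨ unfold-reverse x (Rₓ x P) ⟩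
  ω (Rₓ x P) ++ x ∷ []                   ≈⟨ ·-congˡ (x ∷ []) (mirror-Rₓ x P) ⟩
  ((x ∷ Rₓ x (ω P)) · inv x₁) · x₁       ≈⟨ cancel-inv-right (x ∷ Rₓ x (ω P)) x₁ ⟩
  x ∷ Rₓ x (ω P)                         ≈⟨ ·-congʳ x₁ (subst-cong (imgR x) (palindrome w)) ⟩
  x ∷ Rₓ x P                             ≈⟨ Pal-cons x w ⟨
  Pal (x ∷ w)                            ∎
  where
    open ≃-Reasoning
    P  = Pal w
    x₁ = x ∷ []

proposition4p1 : (w : Word) → ω (Pal w) ≈ Pal w
proposition4p1 w = ≃⇒≈ (palindrome w)
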